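{- If $G$ is a finite bipartite graph with no isolated vertices and maximum degree $\Delta(G)=4$, then $\check s(G)\leq 11$. Moreover, if $G$ has no vertices of degree $1$, then $\check s(G)\leq 7$.
   Context: For a proper edge coloring $\varphi$ of a graph $G$, the palette of a vertex $v$ is the set of colors on edges incident with $v$. The palette index $\check s(G)$ is the minimum number of distinct palettes over all proper edge colorings of $G$. -}

module Defs where

open import Data.Nat using (ℕ; _≤_; _≥_)
open import Data.Fin using (Fin)
open import Data.Bool using (Bool; true; false; if_then_else_)
open import Data.List using (List; map; allFin)
open import Data.Nat.ListAction using (sum)
open import Data.Product using (Σ; _×_; ∃; ∃-syntax)
open import Relation.Binary.PropositionalEquality using (_≡_; _≢_)
open import Function.Bundles using (_⇔_)

record Graph (n : ℕ) : Set where
  field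
    adj   : Fin n → Fin n → Bool
    sym   : ∀ u v → adj u v ≡ adj v u
    irrefl : ∀ v → adj v v ≡ false

open Graph public

Adj : ∀ {n} → Graph n → Fin n → Fin n → Set
Adj G u v = adj G u v ≡ true

degree : ∀ {n} → Graph n → Fin n → ℕ
degree {n} G v = sum (map (λ u → if adj G v u then 1 else 0) (allFin n))

MaxDegree : ∀ {n} → Graph n → ℕ → Set
MaxDegree G d = (∀ v → degree G v ≤ d) × (∃[ v ] degree G v ≡ d)

NoIsolated : ∀ {n} → Graph n → Set
NoIsolated G = ∀ v → degree G v ≥ 1

Bipartite : ∀ {n} → Graph n → Set
Bipartite {n} G = Σ (Fin n → Bool) λ side → ∀ u v → Adj G u v → side u ≢ side v

-- An edge colouring with colours in ℕ: the colour of edge uv is col u v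
-- (values on non-edges are irrelevant); it must be well defined on edges
-- (symmetric) and proper (distinct edges at a vertex get distinct colours).
record ProperEdgeColoring {n : ℕ} (G : Graph n) : Set where
  field
    col    : Fin n → Fin n → ℕ
    col-sym : ∀ u v → Adj G u v → col u v ≡ col v u
    proper : ∀ v u w → Adj G v u → Adj G v w → u ≢ w → col v u ≢ col v w

open ProperEdgeColoring public

InPalette : ∀ {n} {G : Graph n} → ProperEdgeColoring G → Fin n → ℕ → Set
InPalette {G = G} φ v x = ∃[ u ] (Adj G v u × col φ v u ≡ x)

SamePalette : ∀ {n} {G : Graph n} → ProperEdgeColoring G → Fin n → Fin n → Set
SamePalette φ v w = ∀ x → InPalette φ v x ⇔ InPalette φ w x

-- φ uses at most k distinct palettes: the palettes can be labelled by Fin k,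
-- equal labels meaning equal palettes.
AtMostPalettes : ∀ {n} {G : Graph n} → ProperEdgeColoring G → ℕ → Set
AtMostPalettes {n} φ k =
  Σ (Fin n → Fin k) λ lab → ∀ v w → lab v ≡ lab w → SamePalette φ v w

PaletteIndex≤ : ∀ {n} → Graph n → ℕ → Set
PaletteIndex≤ G k = Σ (ProperEdgeColoring G) λ φ → AtMostPalettes φ k

module Submission where

-- We colour the edges with four colours code c s (class bit c, side bit s) so
-- that a vertex of degree two sees a whole class {code c false , code c true}.
-- A palette is then a single colour (degree one), a class (degree two) or has at
-- least three colours: 4 + 2 + 5 = 11 palettes, and 2 + 5 = 7 without degree one.
--
-- Every finite multigraph has a balanced orientation (in- and out-degrees differ
-- by at most one).  Orienting G, each vertex gets at most two arcs out and two in,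
-- a vertex of degree two one of each.  The multigraph H on an out- and an in-copy
-- of each vertex, with an edge per arc and one joining the copies of each vertex
-- of degree two, has maximum degree two; orienting H gives each edge of G a class,
-- distinct on arcs with a common tail or head and equal on the two edges at a
-- vertex of degree two.  The side bit is the side of the tail in the bipartition.

open import Defs hiding (sym)
open import Data.Nat using (ℕ; zero; suc; _+_; _*_; _≤_; _<ᵇ_; _≡ᵇ_; _≤ᵇ_; _<?_; _≤?_; z≤n; s≤s)
open import Data.Nat.Properties
  using (module ≤-Reasoning; +-0-commutativeMonoid; +-assoc; +-comm; +-suc; +-identityʳ;
         *-identityˡ; *-identityʳ; *-zeroʳ; +-mono-≤; +-monoʳ-≤; +-monoˡ-≤; +-mono-<-≤;
         ≤-trans; ≤-pred; ≤-antisym; ≤-reflexive; n≤1+n; <⇒≤; <-irrefl; <-asym; <-cmp;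
         ≮⇒≥; ≰⇒>; ≤⇒≯; ≡ᵇ⇒≡; ≡⇒≡ᵇ; <ᵇ⇒<; <⇒<ᵇ; ≤⇒≤ᵇ)
open import Algebra.Properties.CommutativeMonoid.Sum +-0-commutativeMonoid
  using (sum; sum-remove; ∑-distrib-+; ∑-comm; sum-cong-≗)
open import Data.Fin using (Fin; zero; suc; toℕ; punchIn; punchOut; _↑ˡ_; _↑ʳ_; combine; remQuot; splitAt; #_)
import Data.Fin.Properties as FP
open import Data.Bool using (Bool; true; false; not; _xor_; _∧_; _∨_; if_then_else_; T)
import Data.Bool.Properties as BoolP
open import Data.Maybe using (Maybe; just; nothing)
import Data.Maybe.Properties as MaybeP
open import Data.Product using (Σ; ∃; ∃₂; _×_; _,_; proj₁; proj₂; swap; map; uncurry)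
import Data.Product.Properties as ProdP
open import Data.Sum using (_⊎_; inj₁; inj₂)
open import Data.Empty using (⊥; ⊥-elim)
open import Data.Vec.Functional using (_∷_; []; _++_)
import Data.List as List
import Data.List.Properties as ListP
import Data.Nat.ListAction as ListAction
open import Function using (_∘_)
open import Function.Bundles using (mk⇔; Equivalence)
open import Relation.Binary.Definitions using (DecidableEquality; tri<; tri≈; tri>)
open import Relation.Nullary using (¬_; Dec; yes; no; does)
open import Relation.Nullary.Decidable using (dec-true; dec-false; _⊎-dec_; _×-dec_)
open import Relation.Binary.PropositionalEquality

ι : Bool → ℕ
ι true  = 1
ι false = 0

ι≤1 : ∀ b → ι b ≤ 1
ι≤1 true  = s≤s z≤n
ι≤1 false = z≤n

sum-mono : ∀ {m} {f g : Fin m → ℕ} → (∀ i → f i ≤ g i) → sum f ≤ sum g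
sum-mono {zero}  f≤g = z≤n
sum-mono {suc m} f≤g = +-mono-≤ (f≤g zero) (sum-mono (f≤g ∘ suc))

sum-zero : ∀ {m} {f : Fin m → ℕ} → (∀ i → f i ≡ 0) → sum f ≡ 0
sum-zero {zero}  f≡0 = refl
sum-zero {suc m} f≡0 = cong₂ _+_ (f≡0 zero) (sum-zero (f≡0 ∘ suc))

sum-↑ : ∀ m {k} (f : Fin (m + k) → ℕ) → sum f ≡ sum (λ i → f (i ↑ˡ k)) + sum (λ j → f (m ↑ʳ j))
sum-↑ zero    f = refl
sum-↑ (suc m) f = trans (cong (f zero +_) (sum-↑ m (f ∘ suc))) (sym (+-assoc (f zero) _ _))

sum-combine : ∀ m k (f : Fin (m * k) → ℕ) → sum f ≡ sum (λ i → sum (λ j → f (combine {m} {k} i j)))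
sum-combine zero    k f = refl
sum-combine (suc m) k f =
  trans (sum-↑ k f) (cong (sum (λ j → f (j ↑ˡ (m * k))) +_) (sum-combine m k (λ i → f (k ↑ʳ i))))

sum-at : ∀ {m} (x : Fin m) (g : Fin m → ℕ) → sum (λ p → ι (does (p FP.≟ x)) * g p) ≡ g x
sum-at {suc m} x g = begin
  sum (λ p → δ p * g p)                              ≡⟨ sum-remove {i = x} (λ p → δ p * g p) ⟩
  δ x * g x + sum (λ j → δ (punchIn x j) * g (punchIn x j))
    ≡⟨ cong₂ _+_ (cong (λ b → ι b * g x) (dec-true (x FP.≟ x) refl))
                 (sum-zero (λ j → cong (λ b → ι b * g (punchIn x j))
                                       (dec-false (punchIn x j FP.≟ x) (FP.punchInᵢ≢i x j)))) ⟩
  1 * g x + 0                                        ≡⟨ +-identityʳ _ ⟩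
  1 * g x                                            ≡⟨ *-identityˡ _ ⟩
  g x                                                ∎
  where
    open ≡-Reasoning
    δ : Fin (suc m) → ℕ
    δ p = ι (does (p FP.≟ x))

sum-merge : ∀ {m} (f : Fin (suc (suc m)) → ℕ) (g : Fin (suc m) → ℕ) k t →
            f zero + f (suc k) ≡ t + g zero → (∀ j → f (suc (punchIn k j)) ≡ g (suc j)) →
            sum f ≡ t + sum g
sum-merge f g k t ends rest = begin
  f zero + sum (f ∘ suc)                            ≡⟨ cong (f zero +_) (sum-remove {i = k} (f ∘ suc)) ⟩
  f zero + (f (suc k) + sum (f ∘ suc ∘ punchIn k))  ≡⟨ +-assoc (f zero) _ _ ⟨
  (f zero + f (suc k)) + sum (f ∘ suc ∘ punchIn k)  ≡⟨ cong₂ _+_ ends (sum-cong-≗ rest) ⟩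
  (t + g zero) + sum (g ∘ suc)                      ≡⟨ +-assoc t _ _ ⟩
  t + sum g                                         ∎
  where open ≡-Reasoning

count : ∀ {m} → (Fin m → Bool) → ℕ
count p = sum (ι ∘ p)

count-remove : ∀ {m} (p : Fin (suc m) → Bool) i → count p ≡ ι (p i) + count (p ∘ punchIn i)
count-remove p i = sum-remove {i = i} (ι ∘ p)

count-peel : ∀ {m k} (p : Fin (suc m) → Bool) i → p i ≡ true → k ≤ count (p ∘ punchIn i) → suc k ≤ count p
count-peel p i pi k≤ rewrite count-remove p i | pi = s≤s k≤

witness-peel : ∀ {m k} (p : Fin (suc m) → Bool) → suc k ≤ count p →
               ∃ λ i → p i ≡ true × k ≤ count (p ∘ punchIn i)
witness-peel p k<count with p zero in p0
witness-peel p (s≤s k≤) | true = zero , p0 , k≤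
witness-peel {zero}  p () | false
witness-peel {suc m} p k<count | false =
  let (i , pi , k≤) = witness-peel (p ∘ suc) k<count
  in suc i , pi , subst (λ b → _ ≤ ι b + count (p ∘ suc ∘ punchIn i)) (sym p0) k≤

survives : ∀ {m} (p : Fin (suc m) → Bool) {i j} (i≢j : i ≢ j) → p j ≡ true → (p ∘ punchIn i) (punchOut i≢j) ≡ true
survives p i≢j pj = trans (cong p (FP.punchIn-punchOut i≢j)) pj

count≥1 : ∀ {m} (p : Fin m → Bool) {i} → p i ≡ true → 1 ≤ count p
count≥1 {suc m} p {i} pi = count-peel p i pi z≤n

count≥2 : ∀ {m} (p : Fin m → Bool) {i j} → i ≢ j → p i ≡ true → p j ≡ true → 2 ≤ count p
count≥2 {suc m} p {i} i≢j pi pj = count-peel p i pi (count≥1 (p ∘ punchIn i) (survives p i≢j pj))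

count≥3 : ∀ {m} (p : Fin m → Bool) {i j k} → i ≢ j → i ≢ k → j ≢ k →
          p i ≡ true → p j ≡ true → p k ≡ true → 3 ≤ count p
count≥3 {suc m} p {i} i≢j i≢k j≢k pi pj pk =
  count-peel p i pi (count≥2 (p ∘ punchIn i) (j≢k ∘ FP.punchOut-injective i≢j i≢k)
                             (survives p i≢j pj) (survives p i≢k pk))

at-most-one : ∀ {m} (p : Fin m → Bool) {i j} → count p ≤ 1 → p i ≡ true → p j ≡ true → i ≡ j
at-most-one p {i} {j} count≤1 pi pj with i FP.≟ j
... | yes i≡j = i≡j
... | no  i≢j = ⊥-elim (<-irrefl refl (≤-trans (count≥2 p i≢j pi pj) count≤1))

witness : ∀ {m} (p : Fin m → Bool) → 1 ≤ count p → ∃ λ i → p i ≡ true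
witness {suc m} p 1≤count = let (i , pi , _) = witness-peel p 1≤count in i , pi

witness₂ : ∀ {m} (p : Fin m → Bool) → 2 ≤ count p → ∃₂ λ i j → i ≢ j × p i ≡ true × p j ≡ true
witness₂ {suc m} p 2≤count =
  let (i , pi , 1≤rest) = witness-peel p 2≤count
      (j , pj)          = witness (p ∘ punchIn i) 1≤rest
  in i , punchIn i j , FP.punchInᵢ≢i i j ∘ sym , pi , pj

witness₃ : ∀ {m} (p : Fin m → Bool) → 3 ≤ count p →
           ∃₂ λ i j → ∃ λ k → i ≢ j × i ≢ k × j ≢ k × p i ≡ true × p j ≡ true × p k ≡ true
witness₃ {suc m} p 3≤count =
  let (i , pi , 2≤rest)       = witness-peel p 3≤count
      (j , k , j≢k , pj , pk) = witness₂ (p ∘ punchIn i) 2≤rest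
  in i , punchIn i j , punchIn i k , FP.punchInᵢ≢i i j ∘ sym , FP.punchInᵢ≢i i k ∘ sym ,
     j≢k ∘ FP.punchIn-injective i j k , pi , pj , pk

flip : ∀ {A : Set} → Bool → A × A → A × A
flip false e = e
flip true  e = swap e

flip-xor : ∀ {A : Set} c t (e : A × A) → flip (c xor t) e ≡ flip c (flip t e)
flip-xor false t     e = refl
flip-xor true  false e = refl
flip-xor true  true  e = refl

flip-map : ∀ {A B : Set} (f : A → B) c (e : A × A) → flip c (map f f e) ≡ map f f (flip c e)
flip-map f false e = refl
flip-map f true  e = refl

flip-either : ∀ {A : Set} c {e : A × A} {x u} → e ≡ (x , u) ⊎ e ≡ (u , x) → flip c e ≡ (x , u) ⊎ flip c e ≡ (u , x)
flip-either false ends        = ends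
flip-either true  (inj₁ refl) = inj₂ refl
flip-either true  (inj₂ refl) = inj₁ refl

++-↑ˡ : ∀ {A : Set} {m k} (f : Fin m → A) (g : Fin k → A) i → (f ++ g) (i ↑ˡ k) ≡ f i
++-↑ˡ {m = m} {k} f g i rewrite FP.splitAt-↑ˡ m i k = refl

++-↑ʳ : ∀ {A : Set} {m k} (f : Fin m → A) (g : Fin k → A) j → (f ++ g) (m ↑ʳ j) ≡ g j
++-↑ʳ {m = m} {k} f g j rewrite FP.splitAt-↑ʳ m k j = refl

↑ˡ≢↑ʳ : ∀ {m k} (i : Fin m) (j : Fin k) → i ↑ˡ k ≢ m ↑ʳ j
↑ˡ≢↑ʳ {m} {k} i j eq with trans (sym (FP.splitAt-↑ˡ m i k)) (trans (cong (splitAt m) eq) (FP.splitAt-↑ʳ m k j))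
... | ()

true≢false : true ≢ false
true≢false ()

both-differ : ∀ {a b c : Bool} → a ≢ c → b ≢ c → a ≡ b
both-differ {false} {false} _ _ = refl
both-differ {true}  {true}  _ _ = refl
both-differ {false} {true}  {false} a≢c _ = ⊥-elim (a≢c refl)
both-differ {false} {true}  {true}  _ b≢c = ⊥-elim (b≢c refl)
both-differ {true}  {false} {false} _ b≢c = ⊥-elim (b≢c refl)
both-differ {true}  {false} {true}  a≢c _ = ⊥-elim (a≢c refl)

bool-ext : ∀ {a b : Bool} → (a ≡ true → b ≡ true) → (b ≡ true → a ≡ true) → a ≡ b
bool-ext {false} {false} _   _   = refl
bool-ext {false} {true}  _   b⇒a = b⇒a refl
bool-ext {true}  {false} a⇒b _   = sym (a⇒b refl)
bool-ext {true}  {true}  _   _   = refl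

∨-left : ∀ {a b} → T a → T (a ∨ b)
∨-left t = Equivalence.from BoolP.T-∨ (inj₁ t)

∨-right : ∀ {a b} → T b → T (a ∨ b)
∨-right t = Equivalence.from BoolP.T-∨ (inj₂ t)

Near : ℕ → ℕ → Set
Near p q = p ≤ suc q × q ≤ suc p

near-+ : ∀ t {p q} → Near p q → Near (t + p) (t + q)
near-+ t {p} {q} (p≤ , q≤) = shift p≤ , shift q≤
  where shift : ∀ {r s} → r ≤ suc s → t + r ≤ suc (t + s)
        shift {r} {s} r≤ = subst (t + r ≤_) (+-suc t s) (+-monoʳ-≤ t r≤)

near-≤1 : ∀ {p q} → p ≤ 1 → q ≤ 1 → Near p q
near-≤1 p≤1 q≤1 = ≤-trans p≤1 (s≤s z≤n) , ≤-trans q≤1 (s≤s z≤n)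

near-add-one : ∀ {p q} → Near p q → ∃ λ c → Near (ι (not c) + p) (ι c + q)
near-add-one {p} {q} (p≤ , q≤) with q <? p
... | yes q<p = true  , ≤-trans p≤ (n≤1+n _) , s≤s (<⇒≤ q<p)
... | no  q≮p = false , s≤s (≮⇒≥ q≮p) , ≤-trans q≤ (n≤1+n _)

near-bound : ∀ k {p q} → Near p q → p + q ≤ k + k → p ≤ k × q ≤ k
near-bound k {p} {q} (p≤ , q≤) p+q≤ = half p≤ p+q≤ , half q≤ (subst (_≤ k + k) (+-comm p q) p+q≤)
  where
    half : ∀ {r s} → r ≤ suc s → r + s ≤ k + k → r ≤ k
    half {r} {s} r≤ r+s≤ with r ≤? k
    ... | yes r≤k = r≤k
    ... | no  r≰k = ⊥-elim (≤⇒≯ r+s≤ (+-mono-<-≤ k<r (≤-pred (≤-trans k<r r≤))))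
      where k<r = ≰⇒> r≰k

-- A
-- multigraph is a list of edges Fin m → V × V (loops allowed), an edge (a , b)
-- being read as an arc a → b; an orientation reverses the edges marked true.
module Orientation {V : Set} (_≟_ : DecidableEquality V) where

  δ : V → V → ℕ
  δ a x = ι (does (a ≟ x))

  δ-refl : ∀ x → δ x x ≡ 1
  δ-refl x = cong ι (dec-true (x ≟ x) refl)

  δ-≢ : ∀ {a x} → a ≢ x → δ a x ≡ 0
  δ-≢ {a} {x} a≢x = cong ι (dec-false (a ≟ x) a≢x)

  Edge : Set
  Edge = V × V

  orient : ∀ {m} → (Fin m → Bool) → (Fin m → Edge) → Fin m → Edge
  orient b e i = flip (b i) (e i)

  outdeg indeg : ∀ {m} → (Fin m → Edge) → V → ℕ
  outdeg o x = count (λ i → does (proj₁ (o i) ≟ x))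
  indeg  o x = count (λ i → does (proj₂ (o i) ≟ x))

  -- the number of edge ends at x (a loop at x counts twice)
  incidence : ∀ {m} → (Fin m → Edge) → V → ℕ
  incidence e x = sum (λ i → δ (proj₁ (e i)) x + δ (proj₂ (e i)) x)

  Balanced : ∀ {m} → (Fin m → Edge) → Set
  Balanced o = ∀ x → Near (outdeg o x) (indeg o x)

  BalancedOrientation : ∀ {m} → (Fin m → Edge) → Set
  BalancedOrientation {m} e = Σ (Fin m → Bool) λ b → Balanced (orient b e)

  outdeg-++ : ∀ {m k} (f : Fin m → Edge) (g : Fin k → Edge) x → outdeg (f ++ g) x ≡ outdeg f x + outdeg g x
  outdeg-++ {m} f g x = trans (sum-↑ m _) (cong₂ _+_ (sum-cong-≗ (λ i → cong (λ e → δ (proj₁ e) x) (++-↑ˡ f g i)))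
                                                      (sum-cong-≗ (λ j → cong (λ e → δ (proj₁ e) x) (++-↑ʳ f g j))))

  indeg-++ : ∀ {m k} (f : Fin m → Edge) (g : Fin k → Edge) x → indeg (f ++ g) x ≡ indeg f x + indeg g x
  indeg-++ {m} f g x = trans (sum-↑ m _) (cong₂ _+_ (sum-cong-≗ (λ i → cong (λ e → δ (proj₂ e) x) (++-↑ˡ f g i)))
                                                     (sum-cong-≗ (λ j → cong (λ e → δ (proj₂ e) x) (++-↑ʳ f g j))))

  flip-ends : ∀ c e x → δ (proj₁ (flip c e)) x + δ (proj₂ (flip c e)) x ≡ δ (proj₁ e) x + δ (proj₂ e) x
  flip-ends false e x = refl
  flip-ends true  e x = +-comm (δ (proj₂ e) x) _

  outdeg+indeg : ∀ {m} b (e : Fin m → Edge) x → outdeg (orient b e) x + indeg (orient b e) x ≡ incidence e x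
  outdeg+indeg b e x =
    trans (sym (∑-distrib-+ (λ i → δ (proj₁ (orient b e i)) x) (λ i → δ (proj₂ (orient b e i)) x)))
          (sum-cong-≗ (λ i → flip-ends (b i) (e i) x))

  Avoids : V → Edge → Set
  Avoids x e = proj₁ e ≢ x × proj₂ e ≢ x

  flip-avoids : ∀ c {x e} → Avoids x e → Avoids x (flip c e)
  flip-avoids false avoid   = avoid
  flip-avoids true  (p , q) = q , p

  -- Induction step when the first edge is a loop: it adds one to both degrees.
  loop-step : ∀ {m} a (rest : Fin m → Edge) → BalancedOrientation rest → BalancedOrientation ((a , a) ∷ rest)
  loop-step a rest (b , bal) = (false ∷ b) , λ x → near-+ (δ a x) (bal x)

  -- Induction step when the first edge ay is the only edge at y: orient it so
  -- that a gains one on its smaller side; y ends with degrees at most one.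
  pendant-step : ∀ {m} a y (rest : Fin m → Edge) → a ≢ y → (∀ k → Avoids y (rest k)) →
                 BalancedOrientation rest → BalancedOrientation ((a , y) ∷ rest)
  pendant-step a y rest a≢y y-free (b , bal) = (c ∷ b) , bal′
    where
      o = orient b rest
      c = proj₁ (near-add-one (bal a))

      tail-at-a : ∀ c → δ (proj₁ (flip c (a , y))) a ≡ ι (not c)
      tail-at-a false = δ-refl a
      tail-at-a true  = δ-≢ (a≢y ∘ sym)

      head-at-a : ∀ c → δ (proj₂ (flip c (a , y))) a ≡ ι c
      head-at-a false = δ-≢ (a≢y ∘ sym)
      head-at-a true  = δ-refl a

      silent-at-y : outdeg o y ≡ 0 × indeg o y ≡ 0
      silent-at-y = sum-zero (λ k → δ-≢ (proj₁ (avoids k))) , sum-zero (λ k → δ-≢ (proj₂ (avoids k)))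
        where avoids = λ k → flip-avoids (b k) (y-free k)

      one-end : ∀ {d r} → r ≡ 0 → ι d + r ≤ 1
      one-end {d} refl = subst (_≤ 1) (sym (+-identityʳ (ι d))) (ι≤1 d)

      bal′ : Balanced (orient (c ∷ b) ((a , y) ∷ rest))
      bal′ x with x ≟ a | x ≟ y
      ... | yes refl | _        = subst₂ Near (cong (_+ outdeg o x) (sym (tail-at-a c)))
                                              (cong (_+ indeg o x) (sym (head-at-a c)))
                                              (proj₂ (near-add-one (bal a)))
      ... | no _     | yes refl = near-≤1 (one-end (proj₁ silent-at-y)) (one-end (proj₂ silent-at-y))
      ... | no x≢a   | no x≢y   = let (t , h) = flip-avoids c ((x≢a ∘ sym) , (x≢y ∘ sym))
                                  in subst₂ Near (cong (_+ outdeg o x) (sym (δ-≢ t)))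
                                                 (cong (_+ indeg o x) (sym (δ-≢ h))) (bal x)

  -- Induction step when the first edge ay meets another edge yz: merge them into
  -- one edge az, orient the shorter list, and give both edges the orientation of
  -- az (a path a → y → z or z → y → a), so that y gains one on each side.
  merge-step : ∀ {m} a y (rest : Fin m → Edge) k z t → flip t (rest k) ≡ (y , z) →
               (∀ (e : Fin m → Edge) → BalancedOrientation e) → BalancedOrientation ((a , y) ∷ rest)
  merge-step {suc m} a y rest k z t rest-k ih = b , bal
    where
      merged : Fin (suc m) → Edge
      merged = (a , z) ∷ (rest ∘ punchIn k)
      b′ = proj₁ (ih merged)
      c  = b′ zero

      rest-bit : ∀ i → Dec (k ≡ i) → Bool
      rest-bit i (yes _)  = c xor t
      rest-bit i (no k≢i) = b′ (suc (punchOut k≢i))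

      b : Fin (suc (suc m)) → Bool
      b = c ∷ λ i → rest-bit i (k FP.≟ i)

      o  = orient b ((a , y) ∷ rest)
      o′ = orient b′ merged

      at-k : (d : Dec (k ≡ k)) → flip (rest-bit k d) (rest k) ≡ flip c (y , z)
      at-k (yes _)  = trans (flip-xor c t (rest k)) (cong (flip c) rest-k)
      at-k (no k≢k) = ⊥-elim (k≢k refl)

      elsewhere : ∀ j (d : Dec (k ≡ punchIn k j)) → rest-bit (punchIn k j) d ≡ b′ (suc j)
      elsewhere j (yes k≡) = ⊥-elim (FP.punchInᵢ≢i k j (sym k≡))
      elsewhere j (no k≢)  = cong (b′ ∘ suc) (trans (FP.punchOut-cong k refl) (FP.punchOut-punchIn k))

      same : ∀ j → o (suc (punchIn k j)) ≡ o′ (suc j)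
      same j = cong (λ d → flip d (rest (punchIn k j))) (elsewhere j (k FP.≟ punchIn k j))

      merge-tails : ∀ c x → δ (proj₁ (flip c (a , y))) x + δ (proj₁ (flip c (y , z))) x
                            ≡ δ y x + δ (proj₁ (flip c (a , z))) x
      merge-tails false x = +-comm (δ a x) _
      merge-tails true  x = refl

      merge-heads : ∀ c x → δ (proj₂ (flip c (a , y))) x + δ (proj₂ (flip c (y , z))) x
                            ≡ δ y x + δ (proj₂ (flip c (a , z))) x
      merge-heads false x = refl
      merge-heads true  x = +-comm (δ a x) _

      bal : Balanced o
      bal x = subst₂ Near (sym (sum-merge (λ i → δ (proj₁ (o i)) x) (λ i → δ (proj₁ (o′ i)) x) k (δ y x)
                                          tails (λ j → cong (λ e → δ (proj₁ e) x) (same j))))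
                          (sym (sum-merge (λ i → δ (proj₂ (o i)) x) (λ i → δ (proj₂ (o′ i)) x) k (δ y x)
                                          heads (λ j → cong (λ e → δ (proj₂ e) x) (same j))))
                          (near-+ (δ y x) (proj₂ (ih merged) x))
        where
          tails = trans (cong (λ e → δ (proj₁ (flip c (a , y))) x + δ (proj₁ e) x) (at-k (k FP.≟ k))) (merge-tails c x)
          heads = trans (cong (λ e → δ (proj₂ (flip c (a , y))) x + δ (proj₂ e) x) (at-k (k FP.≟ k))) (merge-heads c x)

  first-edge-step : ∀ {m} a y (rest : Fin m → Edge) → (∀ (e : Fin m → Edge) → BalancedOrientation e) →
                    BalancedOrientation ((a , y) ∷ rest)
  first-edge-step a y rest ih with a ≟ y
  ... | yes refl = loop-step a rest (ih rest)
  ... | no a≢y with FP.any? (λ k → (proj₁ (rest k) ≟ y) ⊎-dec (proj₂ (rest k) ≟ y))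
  ...   | yes (k , inj₁ p) = merge-step a y rest k (proj₂ (rest k)) false (cong (_, proj₂ (rest k)) p) ih
  ...   | yes (k , inj₂ p) = merge-step a y rest k (proj₁ (rest k)) true  (cong (_, proj₁ (rest k)) p) ih
  ...   | no none = pendant-step a y rest a≢y (λ k → (λ p → none (k , inj₁ p)) , (λ p → none (k , inj₂ p))) (ih rest)

  balanced-orientation : ∀ {m} (e : Fin m → Edge) → BalancedOrientation e
  balanced-orientation {zero}  e = (λ ()) , λ x → z≤n , z≤n
  balanced-orientation {suc m} e = first-edge-step (proj₁ (e zero)) (proj₂ (e zero)) (e ∘ suc) balanced-orientation

  tails-unique : ∀ {m} (o : Fin m → Edge) {x i j} → outdeg o x ≤ 1 → proj₁ (o i) ≡ x → proj₁ (o j) ≡ x → i ≡ j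
  tails-unique o {x} out≤1 oi oj = at-most-one _ out≤1 (dec-true (_ ≟ x) oi) (dec-true (_ ≟ x) oj)

  heads-unique : ∀ {m} (o : Fin m → Edge) {x i j} → indeg o x ≤ 1 → proj₂ (o i) ≡ x → proj₂ (o j) ≡ x → i ≡ j
  heads-unique o {x} in≤1 oi oj = at-most-one _ in≤1 (dec-true (_ ≟ x) oi) (dec-true (_ ≟ x) oj)

  orient-kept : ∀ {m} (b : Fin m → Bool) e {i} → b i ≡ false → orient b e i ≡ e i
  orient-kept b e bi rewrite bi = refl

  orient-reversed : ∀ {m} (b : Fin m → Bool) e {i} → b i ≡ true → orient b e i ≡ swap (e i)
  orient-reversed b e bi rewrite bi = refl

  distinct-bits₁ : ∀ {m} (b : Fin m → Bool) (e : Fin m → Edge) {x i j} →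
                   outdeg (orient b e) x ≤ 1 → indeg (orient b e) x ≤ 1 →
                   i ≢ j → proj₁ (e i) ≡ x → proj₁ (e j) ≡ x → b i ≢ b j
  distinct-bits₁ b e {x} {i} {j} out≤1 in≤1 i≢j ei ej bi≡bj = i≢j (by-bit (b i) refl)
    where
      by-bit : ∀ c → b i ≡ c → i ≡ j
      by-bit false bi = tails-unique (orient b e) out≤1 (trans (cong proj₁ (orient-kept b e bi)) ei)
                          (trans (cong proj₁ (orient-kept b e (trans (sym bi≡bj) bi))) ej)
      by-bit true  bi = heads-unique (orient b e) in≤1 (trans (cong proj₂ (orient-reversed b e bi)) ei)
                          (trans (cong proj₂ (orient-reversed b e (trans (sym bi≡bj) bi))) ej)

  distinct-bits₂ : ∀ {m} (b : Fin m → Bool) (e : Fin m → Edge) {x i j} →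
                   outdeg (orient b e) x ≤ 1 → indeg (orient b e) x ≤ 1 →
                   i ≢ j → proj₂ (e i) ≡ x → proj₂ (e j) ≡ x → b i ≢ b j
  distinct-bits₂ b e {x} {i} {j} out≤1 in≤1 i≢j ei ej bi≡bj = i≢j (by-bit (b i) refl)
    where
      by-bit : ∀ c → b i ≡ c → i ≡ j
      by-bit false bi = heads-unique (orient b e) in≤1 (trans (cong proj₂ (orient-kept b e bi)) ei)
                          (trans (cong proj₂ (orient-kept b e (trans (sym bi≡bj) bi))) ej)
      by-bit true  bi = tails-unique (orient b e) out≤1 (trans (cong proj₁ (orient-reversed b e bi)) ei)
                          (trans (cong proj₁ (orient-reversed b e (trans (sym bi≡bj) bi))) ej)

degree-count : ∀ {n} (G : Graph n) v → degree G v ≡ count (adj G v)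
degree-count {n} G v = begin
  ListAction.sum (List.map indicator (List.allFin n))  ≡⟨ cong ListAction.sum (ListP.map-tabulate (λ u → u) indicator) ⟩
  ListAction.sum (List.tabulate indicator)            ≡⟨ sum-tabulate indicator ⟩
  sum indicator                                       ≡⟨ sum-cong-≗ (λ u → if-ι (adj G v u)) ⟩
  count (adj G v)                                     ∎
  where
    open ≡-Reasoning
    indicator : Fin n → ℕ
    indicator u = if adj G v u then 1 else 0
    sum-tabulate : ∀ {m} (g : Fin m → ℕ) → ListAction.sum (List.tabulate g) ≡ sum g
    sum-tabulate {zero}  g = refl
    sum-tabulate {suc m} g = cong (g zero +_) (sum-tabulate (g ∘ suc))
    if-ι : ∀ b → (if b then 1 else 0) ≡ ι b
    if-ι true  = refl
    if-ι false = refl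

-- The edges of G, each listed once as the pair (p , q) with p < q, indexed by
-- Fin (n * n); as a multigraph on Maybe (Fin n) the other indices carry loops at
-- the dummy vertex nothing.
module EdgeList {n : ℕ} (G : Graph n) where

  before : Fin n → Fin n → Bool
  before p q = toℕ p <ᵇ toℕ q

  before-asym : ∀ {p q} → before p q ≡ true → before q p ≡ false
  before-asym {p} {q} pq with before q p in qp
  ... | false = refl
  ... | true  = ⊥-elim (<-asym (<ᵇ⇒< (toℕ p) (toℕ q) (Equivalence.from BoolP.T-≡ pq))
                               (<ᵇ⇒< (toℕ q) (toℕ p) (Equivalence.from BoolP.T-≡ qp)))

  before-total : ∀ {p q} → p ≢ q → before p q ≡ false → before q p ≡ true
  before-total {p} {q} p≢q pq with <-cmp (toℕ p) (toℕ q)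
  ... | tri< p<q _ _ = ⊥-elim (subst T pq (<⇒<ᵇ p<q))
  ... | tri≈ _ p≡q _ = ⊥-elim (p≢q (FP.toℕ-injective p≡q))
  ... | tri> _ _ q<p = Equivalence.to BoolP.T-≡ (<⇒<ᵇ q<p)

  adjacent-distinct : ∀ {x u} → Adj G x u → x ≢ u
  adjacent-distinct {x} xu refl = true≢false (trans (sym xu) (irrefl G x))

  pair : Fin (n * n) → Fin n × Fin n
  pair = remQuot n

  IsEdge : Fin n × Fin n → Bool
  IsEdge (p , q) = adj G p q ∧ before p q

  ordered : Fin n → Fin n → Fin n × Fin n
  ordered x u = if before x u then (x , u) else (u , x)

  edgeIndex : Fin n → Fin n → Fin (n * n)
  edgeIndex x u = uncurry (combine {n} {n}) (ordered x u)

  pair-edgeIndex : ∀ x u → pair (edgeIndex x u) ≡ ordered x u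
  pair-edgeIndex x u = FP.remQuot-combine (proj₁ (ordered x u)) (proj₂ (ordered x u))

  ordered-ends : ∀ x u → ordered x u ≡ (x , u) ⊎ ordered x u ≡ (u , x)
  ordered-ends x u with before x u
  ... | true  = inj₁ refl
  ... | false = inj₂ refl

  ordered-sym : ∀ {x u} → x ≢ u → ordered x u ≡ ordered u x
  ordered-sym {x} {u} x≢u with before x u in xu | before u x in ux
  ... | true  | true  = ⊥-elim (true≢false (trans (sym ux) (before-asym {x} {u} xu)))
  ... | true  | false = refl
  ... | false | true  = refl
  ... | false | false = ⊥-elim (true≢false (trans (sym (before-total x≢u xu)) ux))

  ordered-IsEdge : ∀ {x u} → Adj G x u → IsEdge (ordered x u) ≡ true
  ordered-IsEdge {x} {u} xu with before x u in x<u
  ... | true  = cong₂ _∧_ xu x<u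
  ... | false = cong₂ _∧_ (trans (Graph.sym G u x) xu) (before-total (adjacent-distinct xu) x<u)

  edgeIndex-sym : ∀ {x u} → Adj G x u → edgeIndex x u ≡ edgeIndex u x
  edgeIndex-sym xu = cong (uncurry combine) (ordered-sym (adjacent-distinct xu))

  edgeIndex-injective : ∀ {x u w} → edgeIndex x u ≡ edgeIndex x w → u ≡ w
  edgeIndex-injective {x} {u} {w} eq = by-cases (ordered-ends x u) (ordered-ends x w)
    where
      same : ordered x u ≡ ordered x w
      same = trans (sym (pair-edgeIndex x u)) (trans (cong pair eq) (pair-edgeIndex x w))
      by-cases : ordered x u ≡ (x , u) ⊎ ordered x u ≡ (u , x) →
                 ordered x w ≡ (x , w) ⊎ ordered x w ≡ (w , x) → u ≡ w
      by-cases (inj₁ p) (inj₁ q) = cong proj₂ (trans (sym p) (trans same q))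
      by-cases (inj₁ p) (inj₂ q) = let r = trans (sym p) (trans same q) in trans (cong proj₂ r) (cong proj₁ r)
      by-cases (inj₂ p) (inj₁ q) = let r = trans (sym p) (trans same q) in trans (cong proj₁ r) (cong proj₂ r)
      by-cases (inj₂ p) (inj₂ q) = cong proj₁ (trans (sym p) (trans same q))

  _≟₁_ : DecidableEquality (Maybe (Fin n))
  _≟₁_ = MaybeP.≡-dec FP._≟_

  module O₁ = Orientation _≟₁_

  asEdge₁ : Fin n × Fin n → Maybe (Fin n) × Maybe (Fin n)
  asEdge₁ pq = if IsEdge pq then map just just pq else (nothing , nothing)

  edges₁ : Fin (n * n) → Maybe (Fin n) × Maybe (Fin n)
  edges₁ k = asEdge₁ (pair k)

  incidence-edges₁ : ∀ x → O₁.incidence edges₁ (just x)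
                           ≡ sum (λ q → ι (IsEdge (x , q))) + sum (λ p → ι (IsEdge (p , x)))
  incidence-edges₁ x = begin
    O₁.incidence edges₁ (just x)
      ≡⟨ sum-combine n n _ ⟩
    sum (λ p → sum (λ q → ends-at (pair (combine {n} {n} p q))))
      ≡⟨ sum-cong-≗ (λ p → sum-cong-≗ (λ q → cong ends-at (FP.remQuot-combine p q))) ⟩
    sum (λ p → sum (λ q → ends-at (p , q)))
      ≡⟨ sum-cong-≗ (λ p → trans (sum-cong-≗ (ends-split p))
                                 (∑-distrib-+ (λ q → δ p * r p q) (λ q → δ q * r p q))) ⟩
    sum (λ p → sum (λ q → δ p * r p q) + sum (λ q → δ q * r p q))
      ≡⟨ ∑-distrib-+ (λ p → sum (λ q → δ p * r p q)) (λ p → sum (λ q → δ q * r p q)) ⟩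
    sum (λ p → sum (λ q → δ p * r p q)) + sum (λ p → sum (λ q → δ q * r p q))
      ≡⟨ cong₂ _+_ (trans (∑-comm (λ p q → δ p * r p q)) (sum-cong-≗ (λ q → sum-at x (λ p → r p q))))
                   (sum-cong-≗ (λ p → sum-at x (r p))) ⟩
    sum (λ q → r x q) + sum (λ p → r p x) ∎
    where
      open ≡-Reasoning
      δ : Fin n → ℕ
      δ p = ι (does (p FP.≟ x))
      r : Fin n → Fin n → ℕ
      r p q = ι (IsEdge (p , q))
      ends-at : Fin n × Fin n → ℕ
      ends-at pq = O₁.δ (proj₁ (asEdge₁ pq)) (just x) + O₁.δ (proj₂ (asEdge₁ pq)) (just x)
      ends-split : ∀ p q → ends-at (p , q) ≡ δ p * r p q + δ q * r p q
      ends-split p q with IsEdge (p , q)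
      ... | true  = sym (cong₂ _+_ (*-identityʳ (δ p)) (*-identityʳ (δ q)))
      ... | false = sym (cong₂ _+_ (*-zeroʳ (δ p)) (*-zeroʳ (δ q)))

  listed-once : ∀ x q → ι (IsEdge (x , q)) + ι (IsEdge (q , x)) ≤ ι (adj G x q)
  listed-once x q rewrite Graph.sym G q x with adj G x q
  ... | false = z≤n
  ... | true with before x q in x<q
  ...   | true  rewrite before-asym {x} {q} x<q = s≤s z≤n
  ...   | false = ι≤1 _

  incidence-bound : ∀ x → O₁.incidence edges₁ (just x) ≤ degree G x
  incidence-bound x = begin
    O₁.incidence edges₁ (just x)
      ≡⟨ incidence-edges₁ x ⟩
    sum (λ q → ι (IsEdge (x , q))) + sum (λ p → ι (IsEdge (p , x)))
      ≡⟨ ∑-distrib-+ (λ q → ι (IsEdge (x , q))) (λ p → ι (IsEdge (p , x))) ⟨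
    sum (λ q → ι (IsEdge (x , q)) + ι (IsEdge (q , x)))
      ≤⟨ sum-mono (listed-once x) ⟩
    count (adj G x)
      ≡⟨ degree-count G x ⟨
    degree G x ∎
    where open ≤-Reasoning

-- The four colours code c s, with class bit c and side bit s; the two classes
-- are {0 , 1} and {2 , 3}.
code : Bool → Bool → Fin 4
code false false = # 0
code false true  = # 1
code true  false = # 2
code true  true  = # 3

decode : Fin 4 → Bool × Bool
decode = (false , false) ∷ (false , true) ∷ (true , false) ∷ (true , true) ∷ []

decode-code : ∀ c s → decode (code c s) ≡ (c , s)
decode-code false false = refl
decode-code false true  = refl
decode-code true  false = refl
decode-code true  true  = refl

code-decode : ∀ k → uncurry code (decode k) ≡ k
code-decode zero                   = refl
code-decode (suc zero)             = refl
code-decode (suc (suc zero))       = refl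
code-decode (suc (suc (suc zero))) = refl

decode-injective : ∀ {k k′} → decode k ≡ decode k′ → k ≡ k′
decode-injective {k} {k′} e = trans (sym (code-decode k)) (trans (cong (uncurry code) e) (code-decode k′))

classOf : Fin 4 → Bool
classOf k = proj₁ (decode k)

module Colouring {n : ℕ} (G : Graph n) (side : Fin n → Bool)
                 (bipartite : ∀ u v → Adj G u v → side u ≢ side v)
                 (maxdeg : ∀ v → degree G v ≤ 4) where

  open EdgeList G

  b₁ : Fin (n * n) → Bool
  b₁ = proj₁ (O₁.balanced-orientation edges₁)

  o₁ : Fin (n * n) → Maybe (Fin n) × Maybe (Fin n)
  o₁ = O₁.orient b₁ edges₁

  out₁ in₁ : Fin n → ℕ
  out₁ x = O₁.outdeg o₁ (just x)
  in₁  x = O₁.indeg o₁ (just x)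

  arc : Fin (n * n) → Fin n × Fin n
  arc k = flip (b₁ k) (pair k)

  o₁-at : ∀ {x u} → Adj G x u → o₁ (edgeIndex x u) ≡ map just just (arc (edgeIndex x u))
  o₁-at {x} {u} xu = trans (cong (flip (b₁ k)) (cong (λ b → if b then map just just (pair k) else (nothing , nothing)) listed))
                           (flip-map just (b₁ k) (pair k))
    where
      k = edgeIndex x u
      listed : IsEdge (pair k) ≡ true
      listed = trans (cong IsEdge (pair-edgeIndex x u)) (ordered-IsEdge xu)

  arc-ends : ∀ {x u} → arc (edgeIndex x u) ≡ (x , u) ⊎ arc (edgeIndex x u) ≡ (u , x)
  arc-ends {x} {u} = flip-either (b₁ (edgeIndex x u))
                       (subst (λ e → e ≡ (x , u) ⊎ e ≡ (u , x)) (sym (pair-edgeIndex x u)) (ordered-ends x u))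

  deg2 : Fin n → Bool
  deg2 x = degree G x ≡ᵇ 2

  near₁ : ∀ x → Near (out₁ x) (in₁ x)
  near₁ x = proj₂ (O₁.balanced-orientation edges₁) (just x)

  out₁+in₁≤degree : ∀ x → out₁ x + in₁ x ≤ degree G x
  out₁+in₁≤degree x = subst (_≤ degree G x) (sym (O₁.outdeg+indeg b₁ edges₁ (just x))) (incidence-bound x)

  arcs-bound : ∀ x → out₁ x ≤ 2 × in₁ x ≤ 2
  arcs-bound x = near-bound 2 (near₁ x) (≤-trans (out₁+in₁≤degree x) (maxdeg x))

  arcs-at-degree-two : ∀ {x} → deg2 x ≡ true → out₁ x ≤ 1 × in₁ x ≤ 1
  arcs-at-degree-two {x} d =
    near-bound 1 (near₁ x) (subst (out₁ x + in₁ x ≤_) (≡ᵇ⇒≡ _ 2 (Equivalence.from BoolP.T-≡ d))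
                                  (out₁+in₁≤degree x))

  -- The arcs of G together with a loop at every vertex of degree two (the other
  -- vertices contribute loops at the dummy vertex).
  loop-at : Fin n → Maybe (Fin n)
  loop-at x = if deg2 x then just x else nothing

  loops : Fin n → Maybe (Fin n) × Maybe (Fin n)
  loops x = loop-at x , loop-at x

  arcs⁺ : Fin (n * n + n) → Maybe (Fin n) × Maybe (Fin n)
  arcs⁺ = o₁ ++ loops

  loops-degree : ∀ x → O₁.outdeg loops (just x) ≡ ι (deg2 x)
  loops-degree x = trans (sum-cong-≗ at-j) (sum-at x (ι ∘ deg2))
    where at-j : ∀ j → O₁.δ (loop-at j) (just x) ≡ ι (does (j FP.≟ x)) * ι (deg2 j)
          at-j j with deg2 j
          ... | true  = sym (*-identityʳ _)
          ... | false = sym (*-zeroʳ (ι (does (j FP.≟ x))))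

  arcs⁺-bound : ∀ x → O₁.outdeg arcs⁺ (just x) ≤ 2 × O₁.indeg arcs⁺ (just x) ≤ 2
  arcs⁺-bound x rewrite O₁.outdeg-++ o₁ loops (just x) | O₁.indeg-++ o₁ loops (just x) | loops-degree x
    with deg2 x in d
  ... | true  = let (o≤1 , i≤1) = arcs-at-degree-two d in +-monoˡ-≤ 1 o≤1 , +-monoˡ-≤ 1 i≤1
  ... | false = let (o≤2 , i≤2) = arcs-bound x in +-monoˡ-≤ 0 o≤2 , +-monoˡ-≤ 0 i≤2

  -- The multigraph H on Maybe (Fin n) × Bool: (x , true) and (x , false) are an
  -- out-copy and an in-copy of x, and an arc a → b of arcs⁺ becomes an edge
  -- joining (a , true) and (b , false).
  module O₂ = Orientation (ProdP.≡-dec _≟₁_ BoolP._≟_)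

  split : Maybe (Fin n) × Maybe (Fin n) → (Maybe (Fin n) × Bool) × (Maybe (Fin n) × Bool)
  split (a , b) = (a , true) , (b , false)

  edges₂ : Fin (n * n + n) → (Maybe (Fin n) × Bool) × (Maybe (Fin n) × Bool)
  edges₂ = split ∘ arcs⁺

  δ₂-same : ∀ a b s → O₂.δ (a , s) (b , s) ≡ O₁.δ a b
  δ₂-same a b s = by-cases a b (a ≟₁ b)
    where
      by-cases : ∀ a b → Dec (a ≡ b) → O₂.δ (a , s) (b , s) ≡ O₁.δ a b
      by-cases a _ (yes refl) = trans (O₂.δ-refl (a , s)) (sym (O₁.δ-refl a))
      by-cases a b (no  a≢b)  = trans (O₂.δ-≢ (a≢b ∘ cong proj₁)) (sym (O₁.δ-≢ a≢b))

  δ₂-other : ∀ a b s → O₂.δ (a , not s) (b , s) ≡ 0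
  δ₂-other a b false = O₂.δ-≢ {a , true} {b , false} (true≢false ∘ cong proj₂)
  δ₂-other a b true  = O₂.δ-≢ {a , false} {b , true} (true≢false ∘ sym ∘ cong proj₂)

  incidence-out-copy : ∀ x → O₂.incidence edges₂ (just x , true) ≡ O₁.outdeg arcs⁺ (just x)
  incidence-out-copy x = sum-cong-≗ λ i →
    trans (cong₂ _+_ (δ₂-same (proj₁ (arcs⁺ i)) (just x) true) (δ₂-other (proj₂ (arcs⁺ i)) (just x) true))
          (+-identityʳ _)

  incidence-in-copy : ∀ x → O₂.incidence edges₂ (just x , false) ≡ O₁.indeg arcs⁺ (just x)
  incidence-in-copy x = sum-cong-≗ λ i →
    cong₂ _+_ (δ₂-other (proj₁ (arcs⁺ i)) (just x) false) (δ₂-same (proj₂ (arcs⁺ i)) (just x) false)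

  H-incidence : ∀ x s → O₂.incidence edges₂ (just x , s) ≤ 2
  H-incidence x true  = subst (_≤ 2) (sym (incidence-out-copy x)) (proj₁ (arcs⁺-bound x))
  H-incidence x false = subst (_≤ 2) (sym (incidence-in-copy x)) (proj₂ (arcs⁺-bound x))

  b₂ : Fin (n * n + n) → Bool
  b₂ = proj₁ (O₂.balanced-orientation edges₂)

  H-degrees : ∀ x s → O₂.outdeg (O₂.orient b₂ edges₂) (just x , s) ≤ 1
                    × O₂.indeg (O₂.orient b₂ edges₂) (just x , s) ≤ 1
  H-degrees x s = near-bound 1 (proj₂ (O₂.balanced-orientation edges₂) (just x , s))
                    (subst (_≤ 2) (sym (O₂.outdeg+indeg b₂ edges₂ (just x , s))) (H-incidence x s))

  class : Fin (n * n) → Bool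
  class k = b₂ (k ↑ˡ n)

  loop-class : Fin n → Bool
  loop-class v = b₂ (n * n ↑ʳ v)

  colourOf : Fin (n * n) → Fin 4
  colourOf k = code (class k) (side (proj₁ (arc k)))

  colour : Fin n → Fin n → Fin 4
  colour x u = colourOf (edgeIndex x u)

  colour-sym : ∀ {x u} → Adj G x u → colour x u ≡ colour u x
  colour-sym xu = cong colourOf (edgeIndex-sym xu)

  H-tail : ∀ {x u v} → Adj G x u → proj₁ (arc (edgeIndex x u)) ≡ v →
           proj₁ (edges₂ (edgeIndex x u ↑ˡ n)) ≡ (just v , true)
  H-tail {x} {u} xu t = trans (cong (proj₁ ∘ split) (trans (++-↑ˡ o₁ loops (edgeIndex x u)) (o₁-at xu)))
                              (cong (λ y → just y , true) t)

  H-head : ∀ {x u v} → Adj G x u → proj₂ (arc (edgeIndex x u)) ≡ v →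
           proj₂ (edges₂ (edgeIndex x u ↑ˡ n)) ≡ (just v , false)
  H-head {x} {u} xu h = trans (cong (proj₂ ∘ split) (trans (++-↑ˡ o₁ loops (edgeIndex x u)) (o₁-at xu)))
                              (cong (λ y → just y , false) h)

  H-edges-distinct : ∀ {x u w} → u ≢ w → edgeIndex x u ↑ˡ n ≢ edgeIndex x w ↑ˡ n
  H-edges-distinct u≢w = u≢w ∘ edgeIndex-injective ∘ FP.↑ˡ-injective _ _ _

  -- Edges at x of the same class and side have the same role at x (tail or head,
  -- as G is bipartite), so they meet in H, which they cannot.
  colour-proper : ∀ {x u w} → Adj G x u → Adj G x w → u ≢ w → colour x u ≢ colour x w
  colour-proper {x} {u} {w} xu xw u≢w same = by-roles arc-ends arc-ends
    where
      ku = edgeIndex x u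
      kw = edgeIndex x w
      parts : (class ku , side (proj₁ (arc ku))) ≡ (class kw , side (proj₁ (arc kw)))
      parts = trans (sym (decode-code _ _)) (trans (cong decode same) (decode-code _ _))
      same-class = cong proj₁ parts
      same-side  = cong proj₂ parts
      by-roles : arc ku ≡ (x , u) ⊎ arc ku ≡ (u , x) → arc kw ≡ (x , w) ⊎ arc kw ≡ (w , x) → ⊥
      by-roles (inj₁ xu-arc) (inj₁ xw-arc) =
        O₂.distinct-bits₁ b₂ edges₂ (proj₁ (H-degrees x true)) (proj₂ (H-degrees x true)) (H-edges-distinct u≢w)
                          (H-tail xu (cong proj₁ xu-arc)) (H-tail xw (cong proj₁ xw-arc)) same-class
      by-roles (inj₂ ux-arc) (inj₂ wx-arc) =
        O₂.distinct-bits₂ b₂ edges₂ (proj₁ (H-degrees x false)) (proj₂ (H-degrees x false)) (H-edges-distinct u≢w)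
                          (H-head xu (cong proj₂ ux-arc)) (H-head xw (cong proj₂ wx-arc)) same-class
      by-roles (inj₁ xu-arc) (inj₂ wx-arc) =
        bipartite x w xw (trans (cong (side ∘ proj₁) (sym xu-arc)) (trans same-side (cong (side ∘ proj₁) wx-arc)))
      by-roles (inj₂ ux-arc) (inj₁ xw-arc) =
        bipartite x u xu (trans (cong (side ∘ proj₁) (sym xw-arc)) (trans (sym same-side) (cong (side ∘ proj₁) ux-arc)))

  loop-H : ∀ {v} → deg2 v ≡ true → edges₂ (n * n ↑ʳ v) ≡ ((just v , true) , (just v , false))
  loop-H {v} d = trans (cong split (++-↑ʳ o₁ loops v)) (cong (λ a → (a , true) , (a , false)) loop-just)
    where loop-just : loop-at v ≡ just v
          loop-just = cong (λ b → if b then just v else nothing) d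

  leaving-class : ∀ {v u} → deg2 v ≡ true → Adj G v u → proj₁ (arc (edgeIndex v u)) ≡ v →
                  class (edgeIndex v u) ≢ loop-class v
  leaving-class {v} d vu t = O₂.distinct-bits₁ b₂ edges₂ (proj₁ (H-degrees v true)) (proj₂ (H-degrees v true))
                               (↑ˡ≢↑ʳ _ v) (H-tail vu t) (cong proj₁ (loop-H d))

  entering-class : ∀ {v u} → deg2 v ≡ true → Adj G v u → proj₂ (arc (edgeIndex v u)) ≡ v →
                   class (edgeIndex v u) ≢ loop-class v
  entering-class {v} d vu h = O₂.distinct-bits₂ b₂ edges₂ (proj₁ (H-degrees v false)) (proj₂ (H-degrees v false))
                                (↑ˡ≢↑ʳ _ v) (H-head vu h) (cong proj₂ (loop-H d))

  degree-two-class : ∀ {v u w} → deg2 v ≡ true → Adj G v u → Adj G v w → u ≢ w →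
                     class (edgeIndex v u) ≡ class (edgeIndex v w)
  degree-two-class {v} {u} {w} d vu vw u≢w = by-roles arc-ends arc-ends
    where
      ku = edgeIndex v u
      kw = edgeIndex v w
      out≤1 = proj₁ (arcs-at-degree-two d)
      in≤1  = proj₂ (arcs-at-degree-two d)
      in-o₁ : ∀ {w} (vw : Adj G v w) {e} → arc (edgeIndex v w) ≡ e → o₁ (edgeIndex v w) ≡ map just just e
      in-o₁ vw arc≡ = trans (o₁-at vw) (cong (map just just) arc≡)
      by-roles : arc ku ≡ (v , u) ⊎ arc ku ≡ (u , v) → arc kw ≡ (v , w) ⊎ arc kw ≡ (w , v) → class ku ≡ class kw
      by-roles (inj₁ vu-arc) (inj₁ vw-arc) = ⊥-elim (u≢w (edgeIndex-injective
        (O₁.tails-unique o₁ out≤1 (cong proj₁ (in-o₁ vu vu-arc)) (cong proj₁ (in-o₁ vw vw-arc)))))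
      by-roles (inj₂ uv-arc) (inj₂ wv-arc) = ⊥-elim (u≢w (edgeIndex-injective
        (O₁.heads-unique o₁ in≤1 (cong proj₂ (in-o₁ vu uv-arc)) (cong proj₂ (in-o₁ vw wv-arc)))))
      by-roles (inj₁ vu-arc) (inj₂ wv-arc) =
        both-differ (leaving-class d vu (cong proj₁ vu-arc)) (entering-class d vw (cong proj₂ wv-arc))
      by-roles (inj₂ uv-arc) (inj₁ vw-arc) =
        both-differ (entering-class d vu (cong proj₂ uv-arc)) (leaving-class d vw (cong proj₁ vw-arc))

  class-at-degree-two : ∀ {v u w} → degree G v ≡ 2 → Adj G v u → Adj G v w → u ≢ w →
                        classOf (colour v u) ≡ classOf (colour v w)
  class-at-degree-two d vu vw u≢w =
    trans (cong proj₁ (decode-code _ _))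
          (trans (degree-two-class (cong (_≡ᵇ 2) d) vu vw u≢w) (sym (cong proj₁ (decode-code _ _))))

-- Palettes of a colouring with four colours are 4-bit vectors.
Bits4 : Set
Bits4 = Bool × Bool × Bool × Bool

bits : (Fin 4 → Bool) → Bits4
bits P = P (# 0) , P (# 1) , P (# 2) , P (# 3)

bits-cong : ∀ {P Q} → (∀ k → P k ≡ Q k) → bits P ≡ bits Q
bits-cong P≗Q = cong₂ _,_ (P≗Q _) (cong₂ _,_ (P≗Q _) (cong₂ _,_ (P≗Q _) (P≗Q _)))

bits-injective : ∀ {P Q} → bits P ≡ bits Q → ∀ k → P k ≡ Q k
bits-injective eq zero                   = cong proj₁ eq
bits-injective eq (suc zero)             = cong (proj₁ ∘ proj₂) eq
bits-injective eq (suc (suc zero))       = cong (proj₁ ∘ proj₂ ∘ proj₂) eq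
bits-injective eq (suc (suc (suc zero))) = cong (proj₂ ∘ proj₂ ∘ proj₂) eq

entry : Bits4 → Fin 4 → Bool
entry (a , b , c , d) = a ∷ b ∷ c ∷ d ∷ []

weight : Bits4 → ℕ
weight t = count (entry t)

IsClass : Bits4 → Bool
IsClass (true  , true  , false , false) = true
IsClass (false , false , true  , true ) = true
IsClass _                               = false

classPalette : Bool → Fin 4 → Bool
classPalette c k = does (classOf k BoolP.≟ c)

IsClass-classPalette : ∀ c → IsClass (bits (classPalette c)) ≡ true
IsClass-classPalette false = refl
IsClass-classPalette true  = refl

shape11 : Bits4 → Bool
shape11 t = (weight t ≡ᵇ 1) ∨ IsClass t ∨ (3 ≤ᵇ weight t)

shape7 : Bits4 → Bool
shape7 t = IsClass t ∨ (3 ≤ᵇ weight t)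

label11 : Bits4 → Fin 11
label11 (true  , false , false , false) = # 0
label11 (false , true  , false , false) = # 1
label11 (false , false , true  , false) = # 2
label11 (false , false , false , true ) = # 3
label11 (true  , true  , false , false) = # 4
label11 (false , false , true  , true ) = # 5
label11 (false , true  , true  , true ) = # 6
label11 (true  , false , true  , true ) = # 7
label11 (true  , true  , false , true ) = # 8
label11 (true  , true  , true  , false) = # 9
label11 _                               = # 10

unlabel11 : Fin 11 → Bits4
unlabel11 =
    (true  , false , false , false)
  ∷ (false , true  , false , false)
  ∷ (false , false , true  , false)
  ∷ (false , false , false , true )
  ∷ (true  , true  , false , false)
  ∷ (false , false , true  , true )
  ∷ (false , true  , true  , true )
  ∷ (true  , false , true  , true )
  ∷ (true  , true  , false , true )
  ∷ (true  , true  , true  , false)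
  ∷ (true  , true  , true  , true )
  ∷ []

unlabel-label11 : ∀ t → T (shape11 t) → unlabel11 (label11 t) ≡ t
unlabel-label11 (false , false , false , false) ()
unlabel-label11 (false , false , false , true ) _ = refl
unlabel-label11 (false , false , true  , false) _ = refl
unlabel-label11 (false , false , true  , true ) _ = refl
unlabel-label11 (false , true  , false , false) _ = refl
unlabel-label11 (false , true  , false , true ) ()
unlabel-label11 (false , true  , true  , false) ()
unlabel-label11 (false , true  , true  , true ) _ = refl
unlabel-label11 (true  , false , false , false) _ = refl
unlabel-label11 (true  , false , false , true ) ()
unlabel-label11 (true  , false , true  , false) ()
unlabel-label11 (true  , false , true  , true ) _ = refl
unlabel-label11 (true  , true  , false , false) _ = refl
unlabel-label11 (true  , true  , false , true ) _ = refl
unlabel-label11 (true  , true  , true  , false) _ = refl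
unlabel-label11 (true  , true  , true  , true ) _ = refl

label7 : Bits4 → Fin 7
label7 (true  , true  , false , false) = # 0
label7 (false , false , true  , true ) = # 1
label7 (false , true  , true  , true ) = # 2
label7 (true  , false , true  , true ) = # 3
label7 (true  , true  , false , true ) = # 4
label7 (true  , true  , true  , false) = # 5
label7 _                               = # 6

unlabel7 : Fin 7 → Bits4
unlabel7 =
    (true  , true  , false , false)
  ∷ (false , false , true  , true )
  ∷ (false , true  , true  , true )
  ∷ (true  , false , true  , true )
  ∷ (true  , true  , false , true )
  ∷ (true  , true  , true  , false)
  ∷ (true  , true  , true  , true )
  ∷ []

unlabel-label7 : ∀ t → T (shape7 t) → unlabel7 (label7 t) ≡ t
unlabel-label7 (false , false , false , false) ()
unlabel-label7 (false , false , false , true ) ()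
unlabel-label7 (false , false , true  , false) ()
unlabel-label7 (false , false , true  , true ) _ = refl
unlabel-label7 (false , true  , false , false) ()
unlabel-label7 (false , true  , false , true ) ()
unlabel-label7 (false , true  , true  , false) ()
unlabel-label7 (false , true  , true  , true ) _ = refl
unlabel-label7 (true  , false , false , false) ()
unlabel-label7 (true  , false , false , true ) ()
unlabel-label7 (true  , false , true  , false) ()
unlabel-label7 (true  , false , true  , true ) _ = refl
unlabel-label7 (true  , true  , false , false) _ = refl
unlabel-label7 (true  , true  , false , true ) _ = refl
unlabel-label7 (true  , true  , true  , false) _ = refl
unlabel-label7 (true  , true  , true  , true ) _ = refl

module Palettes {n : ℕ} (G : Graph n) (colour : Fin n → Fin n → Fin 4)
                (colour-sym : ∀ {x u} → Adj G x u → colour x u ≡ colour u x)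
                (colour-proper : ∀ {x u w} → Adj G x u → Adj G x w → u ≢ w → colour x u ≢ colour x w) where

  φ : ProperEdgeColoring G
  φ = record
    { col     = λ x u → toℕ (colour x u)
    ; col-sym = λ x u xu → cong toℕ (colour-sym xu)
    ; proper  = λ x u w xu xw u≢w → colour-proper xu xw u≢w ∘ FP.toℕ-injective
    }

  palette : Fin n → Fin 4 → Bool
  palette v k = does (FP.any? λ u → (adj G v u BoolP.≟ true) ×-dec (colour v u FP.≟ k))

  palette-intro : ∀ {v u} → Adj G v u → palette v (colour v u) ≡ true
  palette-intro {v} {u} vu = dec-true (FP.any? _) (u , vu , refl)

  palette-elim : ∀ {v k} → palette v k ≡ true → ∃ λ u → Adj G v u × colour v u ≡ k
  palette-elim {v} {k} p with FP.any? (λ u → (adj G v u BoolP.≟ true) ×-dec (colour v u FP.≟ k))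
  ... | yes found = found

  same-palette : ∀ v w → (∀ k → palette v k ≡ palette w k) → SamePalette φ v w
  same-palette v w same x = mk⇔ (transfer same) (transfer (sym ∘ same))
    where
      transfer : ∀ {v w} → (∀ k → palette v k ≡ palette w k) → InPalette φ v x → InPalette φ w x
      transfer {v} same (u , vu , refl) =
        let (u′ , wu′ , c≡) = palette-elim (trans (sym (same (colour v u))) (palette-intro vu))
        in u′ , wu′ , cong toℕ c≡

  palettes-labelled : ∀ {k} (shape : Bits4 → Bool) (label : Bits4 → Fin k) (unlabel : Fin k → Bits4) →
                      (∀ t → T (shape t) → unlabel (label t) ≡ t) →
                      (∀ v → T (shape (bits (palette v)))) → PaletteIndex≤ G k
  palettes-labelled shape label unlabel unlabel-label shaped =
    φ , (label ∘ bits ∘ palette) , λ v w same-label →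
      same-palette v w (bits-injective (trans (sym (unlabel-label _ (shaped v)))
                                       (trans (cong unlabel same-label) (unlabel-label _ (shaped w)))))

  neighbours : ∀ {v j} → j ≤ degree G v → j ≤ count (adj G v)
  neighbours {v} = subst (_ ≤_) (degree-count G v)

  palette-nonempty : ∀ {v} → 1 ≤ degree G v → 1 ≤ count (palette v)
  palette-nonempty {v} 1≤d = let (u , vu) = witness (adj G v) (neighbours 1≤d)
                             in count≥1 (palette v) (palette-intro vu)

  colours-apart : ∀ {v u u′} → colour v u ≢ colour v u′ → u ≢ u′
  colours-apart c≢c′ refl = c≢c′ refl

  palette-single : ∀ {v} → degree G v ≡ 1 → count (palette v) ≡ 1
  palette-single {v} d = ≤-antisym (≮⇒≥ two-colours) (palette-nonempty (≤-reflexive (sym d)))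
    where
      one<two : ¬ (2 ≤ 1)
      one<two (s≤s ())
      two-colours : ¬ (2 ≤ count (palette v))
      two-colours 2≤ =
        let (k , k′ , k≢k′ , pk , pk′) = witness₂ (palette v) 2≤
            (u  , vu  , cu)  = palette-elim pk
            (u′ , vu′ , cu′) = palette-elim pk′
            u≢u′ = colours-apart (λ c≡ → k≢k′ (trans (sym cu) (trans c≡ cu′)))
        in one<two (subst (2 ≤_) (trans (sym (degree-count G v)) d) (count≥2 (adj G v) u≢u′ vu vu′))

  palette-large : ∀ {v} → 3 ≤ degree G v → 3 ≤ count (palette v)
  palette-large {v} 3≤d =
    let (u₁ , u₂ , u₃ , u₁≢u₂ , u₁≢u₃ , u₂≢u₃ , vu₁ , vu₂ , vu₃) = witness₃ (adj G v) (neighbours 3≤d)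
    in count≥3 (palette v) (colour-proper vu₁ vu₂ u₁≢u₂) (colour-proper vu₁ vu₃ u₁≢u₃)
                           (colour-proper vu₂ vu₃ u₂≢u₃)
               (palette-intro vu₁) (palette-intro vu₂) (palette-intro vu₃)

  -- If all colours at v lie in class c, two edges at v already use up the class.
  palette-of-class : ∀ {v a b} c → Adj G v a → Adj G v b → a ≢ b →
                     (∀ {u} → Adj G v u → classOf (colour v u) ≡ c) → ∀ k → palette v k ≡ classPalette c k
  palette-of-class {v} {a} {b} c va vb a≢b in-class k = bool-ext inside covered
    where
      inside : palette v k ≡ true → classPalette c k ≡ true
      inside pk = let (u , vu , cu) = palette-elim pk
                  in dec-true (classOf k BoolP.≟ c) (trans (cong classOf (sym cu)) (in-class vu))

      sideOf : Fin n → Bool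
      sideOf u = proj₂ (decode (colour v u))

      hit : ∀ {u} → Adj G v u → classOf k ≡ c → proj₂ (decode k) ≡ sideOf u → palette v k ≡ true
      hit vu ck sk = subst (λ k → palette v k ≡ true)
                           (decode-injective (cong₂ _,_ (trans (in-class vu) (sym ck)) (sym sk)))
                           (palette-intro vu)

      sides-differ : sideOf b ≢ sideOf a
      sides-differ s≡ = colour-proper va vb a≢b
                          (decode-injective (cong₂ _,_ (trans (in-class va) (sym (in-class vb))) (sym s≡)))

      covered : classPalette c k ≡ true → palette v k ≡ true
      covered pk with classOf k BoolP.≟ c | proj₂ (decode k) BoolP.≟ sideOf a
      ... | yes ck | yes sa  = hit va ck sa
      ... | yes ck | no  s≢a = hit vb ck (both-differ s≢a sides-differ)
      covered () | no _ | _

  module Shapes (no-isolated : NoIsolated G)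
                (class-at-degree-two : ∀ {v u w} → degree G v ≡ 2 → Adj G v u → Adj G v w → u ≢ w →
                                       classOf (colour v u) ≡ classOf (colour v w)) where

    single-shape : ∀ {v} → degree G v ≡ 1 → T (weight (bits (palette v)) ≡ᵇ 1)
    single-shape d = ≡⇒≡ᵇ _ 1 (palette-single d)

    class-shape : ∀ {v} → degree G v ≡ 2 → T (IsClass (bits (palette v)))
    class-shape {v} d = from-two (witness₂ (adj G v) (neighbours (≤-reflexive (sym d))))
      where
        from-two : (∃₂ λ a b → a ≢ b × Adj G v a × Adj G v b) → T (IsClass (bits (palette v)))
        from-two (a , b , a≢b , va , vb) =
          Equivalence.from BoolP.T-≡
            (trans (cong IsClass (bits-cong (palette-of-class c va vb a≢b in-class))) (IsClass-classPalette c))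
          where
            c = classOf (colour v a)
            in-class : ∀ {u} → Adj G v u → classOf (colour v u) ≡ c
            in-class {u} vu with u FP.≟ a
            ... | yes refl = refl
            ... | no u≢a   = class-at-degree-two d vu va u≢a

    large-shape : ∀ {v} → 3 ≤ degree G v → T (3 ≤ᵇ weight (bits (palette v)))
    large-shape 3≤d = ≤⇒≤ᵇ (palette-large 3≤d)

    degree-cases : ∀ v → degree G v ≡ 1 ⊎ degree G v ≡ 2 ⊎ 3 ≤ degree G v
    degree-cases v with degree G v | no-isolated v
    ... | suc zero          | _ = inj₁ refl
    ... | suc (suc zero)    | _ = inj₂ (inj₁ refl)
    ... | suc (suc (suc _)) | _ = inj₂ (inj₂ (s≤s (s≤s (s≤s z≤n))))

    shaped11 : ∀ v → T (shape11 (bits (palette v)))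
    shaped11 v with degree-cases v
    ... | inj₁ d        = ∨-left {b = IsClass t ∨ (3 ≤ᵇ weight t)} (single-shape d)
      where t = bits (palette v)
    ... | inj₂ (inj₁ d) = ∨-right {a = weight t ≡ᵇ 1} (∨-left {b = 3 ≤ᵇ weight t} (class-shape d))
      where t = bits (palette v)
    ... | inj₂ (inj₂ d) = ∨-right {a = weight t ≡ᵇ 1} (∨-right {a = IsClass t} (large-shape d))
      where t = bits (palette v)

    shaped7 : (∀ v → degree G v ≢ 1) → ∀ v → T (shape7 (bits (palette v)))
    shaped7 no-leaf v with degree-cases v
    ... | inj₁ d        = ⊥-elim (no-leaf v d)
    ... | inj₂ (inj₁ d) = ∨-left {b = 3 ≤ᵇ weight t} (class-shape d)
      where t = bits (palette v)
    ... | inj₂ (inj₂ d) = ∨-right {a = IsClass t} (large-shape d)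
      where t = bits (palette v)

corollary3p2 : (n : ℕ) (G : Graph n) → Bipartite G → NoIsolated G → MaxDegree G 4 →
    PaletteIndex≤ G 11 × ((∀ v → degree G v ≢ 1) → PaletteIndex≤ G 7)
corollary3p2 n G (side , bipartite) no-isolated (maxdeg , _) =
    palettes-labelled shape11 label11 unlabel11 unlabel-label11 shaped11
  , λ no-leaf → palettes-labelled shape7 label7 unlabel7 unlabel-label7 (shaped7 no-leaf)
  where
    open Colouring G side bipartite maxdeg
    open Palettes G colour colour-sym colour-proper
    open Shapes no-isolated class-at-degree-two
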